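{- Let $k,l$ be positive integers and let $G=(A\uplus B,E)$ be a bipartite graph with $|A|\ge k$, $|B|\ge l$. If $G$ is $(k,l)$-minimal, then $G$ is $(k,l)$-Laman.
   Context: $G$ is $(k,l)$-Laman if (i) $|E|=l|A|+k|B|-kl$ and (ii) every induced subgraph $G[A'\uplus B']$ with $|A'|\ge k$ and $|B'|\ge l$ has at most $l|A'|+k|B'|-kl$ edges. $G$ is $(k,l)$-minimal if it is $(k,l)$-rigid and deleting any edge gives a graph that is not $(k,l)$-rigid. Rigidity: fix generic reals (algebraically independent over $\mathbb{Q}$) $\theta_{ia}$ ($1\le i\le k$, $a\in A$) and $\theta_{i'b}$ ($1\le i\le l$, $b\in B$); the bipartite $(k,l)$-rigidity matrix $R^{(k,l)}(G)$ is the $|E|\times(l|A|+k|B|)$ matrix with columns in blocks of $l$ per vertex of $A$ and $k$ per vertex of $B$, whose row for edge $ab$ has $(\theta_{i'b})_{1\le i\le l}$ in the block of $a$, $(\theta_{ia})_{1\le i\le k}$ in the block of $b$, and zeros elsewhere. $G$ is $(k,l)$-rigid iff $\operatorname{rank}R^{(k,l)}(G)=l|A|+k|B|-kl$, and $(k,l)$-stress free iff the rows of $R^{(k,l)}(G)$ are linearly independent. (In the paper these notions are defined via balanced shifting: $G$ is $(k,l)$-rigid iff all pairs containing one of the first $k$ vertices of $A$ or first $l$ vertices of $B$ are edges of the balanced shifting w.r.t. a $(k,l)$-admissible order, and stress free iff the pair of $(k+1)$-st and $(l+1)$-st vertices is not; the two formulations are equivalent.) -}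

module Defs where

open import Data.Nat as ℕ using (ℕ; zero; suc; _∸_; _≤_)
open import Data.Bool using (Bool; true; false; _∧_; if_then_else_)
open import Data.Fin using (Fin; zero; suc)
open import Data.Fin.Properties using (_≟_)
open import Data.Fin.Subset using (Subset; _∈_) renaming (∣_∣ to card)
open import Data.Vec using (lookup)
open import Data.Product using (Σ; _×_; _,_; ∃)
open import Data.Sum using (_⊎_; inj₁; inj₂)
open import Data.Rational using (ℚ; 0ℚ; _+_; _*_)
open import Relation.Nullary using (¬_; does)
open import Relation.Binary.PropositionalEquality using (_≡_)

-- A bipartite graph with sides A = Fin m and B = Fin n; the edge set is
-- given by its indicator function (a simple bipartite graph).
EdgeSet : ℕ → ℕ → Set
EdgeSet m n = Fin m → Fin n → Bool

sumℕ : ∀ {p} → (Fin p → ℕ) → ℕ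
sumℕ {zero}  f = 0
sumℕ {suc p} f = f zero ℕ.+ sumℕ (λ i → f (suc i))

sumℚ : ∀ {p} → (Fin p → ℚ) → ℚ
sumℚ {zero}  f = 0ℚ
sumℚ {suc p} f = f zero + sumℚ (λ i → f (suc i))

bit : Bool → ℕ
bit true  = 1
bit false = 0

numEdges : ∀ {m n} → EdgeSet m n → ℕ
numEdges E = sumℕ (λ a → sumℕ (λ b → bit (E a b)))

inducedEdges : ∀ {m n} → EdgeSet m n → Subset m → Subset n → ℕ
inducedEdges E A' B' =
  sumℕ (λ a → sumℕ (λ b → bit (E a b ∧ lookup A' a ∧ lookup B' b)))

Laman : (k l : ℕ) → ∀ {m n} → EdgeSet m n → Set
Laman k l {m} {n} E =
  (numEdges E ≡ (l ℕ.* m ℕ.+ k ℕ.* n) ∸ (k ℕ.* l)) ×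
  (∀ (A' : Subset m) (B' : Subset n) → k ≤ card A' → l ≤ card B' →
     inducedEdges E A' B' ≤ (l ℕ.* card A' ℕ.+ k ℕ.* card B') ∸ (k ℕ.* l))

Params : (k l m n : ℕ) → Set
Params k l m n = (Fin k → Fin m → ℚ) × (Fin l → Fin n → ℚ)

Col : (k l m n : ℕ) → Set
Col k l m n = (Fin m × Fin l) ⊎ (Fin n × Fin k)

-- entry of the (k,l)-rigidity matrix in the row of the pair ab (a row of the
-- matrix iff ab ∈ E) and the given column
rigEntry : ∀ {k l m n} → Params k l m n → Fin m → Fin n → Col k l m n → ℚ
rigEntry (θA , θB) a b (inj₁ (a' , i)) = if does (a ≟ a') then θB i b else 0ℚ
rigEntry (θA , θB) a b (inj₂ (b' , i)) = if does (b ≟ b') then θA i a else 0ℚ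

RowsIndependent : ∀ {k l m n} → Params k l m n → EdgeSet m n → Set
RowsIndependent {k} {l} {m} {n} θ S =
  ∀ (c : Fin m → Fin n → ℚ) →
    (∀ a b → S a b ≡ false → c a b ≡ 0ℚ) →
    (∀ (col : Col k l m n) →
       sumℚ (λ a → sumℚ (λ b → c a b * rigEntry θ a b col)) ≡ 0ℚ) →
    ∀ a b → c a b ≡ 0ℚ

SubEdges : ∀ {m n} → EdgeSet m n → EdgeSet m n → Set
SubEdges S E = ∀ a b → S a b ≡ true → E a b ≡ true

-- rank R(θ, E) ≥ r : some r rows are linearly independent
RankAtLeast : ∀ {k l m n} → Params k l m n → EdgeSet m n → ℕ → Set
RankAtLeast θ E r =
  Σ _ (λ S → SubEdges S E × (numEdges S ≡ r) × RowsIndependent θ S)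

-- generic rank ≥ r. The generic rank (rank at algebraically independent
-- reals = rank over ℚ(θ)) equals the maximum of the ranks at rational
-- specialisations of θ.
GenericRankAtLeast : (k l : ℕ) → ∀ {m n} → EdgeSet m n → ℕ → Set
GenericRankAtLeast k l {m} {n} E r = ∃ λ (θ : Params k l m n) → RankAtLeast θ E r

Rigid : (k l : ℕ) → ∀ {m n} → EdgeSet m n → Set
Rigid k l {m} {n} E =
  let N = (l ℕ.* m ℕ.+ k ℕ.* n) ∸ (k ℕ.* l) in
  GenericRankAtLeast k l E N × ¬ GenericRankAtLeast k l E (suc N)

deleteEdge : ∀ {m n} → EdgeSet m n → Fin m → Fin n → EdgeSet m n
deleteEdge E a b a' b' = if does (a ≟ a') ∧ does (b ≟ b') then false else E a' b'

Minimal : (k l : ℕ) → ∀ {m n} → EdgeSet m n → Set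
Minimal k l E =
  Rigid k l E × (∀ a b → E a b ≡ true → ¬ Rigid k l (deleteEdge E a b))

module Submission where

-- A minimal rigid graph is independent: rigidity provides rational parameters θ and an
-- independent set S ⊆ E of l|A| + k|B| − kl rows, and an edge outside S could be deleted
-- without losing rigidity, so S = E. Independence bounds every induced subgraph
-- T = G[A′ ⊎ B′]. Bring the rows of θ_A on A′ to reduced echelon form, of rank r ≤ k. A vector
-- on the edges of T is a stress as soon as it satisfies r conditions per vertex of B′ and l
-- per non-pivot vertex of A′, that is r|B′| + l(|A′| − r) ≤ l|A′| + k|B′| − kl conditions
-- (using |B′| ≥ l). With more edges than that, T would carry a nonzero stress.

open import Defs
open import Data.Nat using (ℕ; zero; suc; _≤_; _<_; _∸_; z≤n; s≤s)
import Data.Nat as ℕ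
import Data.Nat.Properties as ℕ
import Data.Nat.Solver as ℕ-Solver
open import Data.Bool using (Bool; true; false; _∧_; if_then_else_)
open import Data.Bool.Properties using (¬-not; ∧-zeroʳ) renaming (_≟_ to _≟ᵇ_)
open import Data.Fin using (Fin; zero; suc)
open import Data.Fin.Properties using (_≟_; any?)
import Data.Fin.Properties as Fin
open import Data.Fin.Subset using (Subset) renaming (∣_∣ to card)
open import Data.Vec using (lookup; _∷_; [])
open import Data.Vec.Functional using (Vector) renaming (_∷_ to _◂_)
open import Data.Rational using (ℚ; 0ℚ; 1ℚ; _+_; _*_; _-_; 1/_; ≢-nonZero)
import Data.Rational.Properties as ℚ
open import Data.Rational.Solver using (module +-*-Solver)
open import Data.List using (List; []; _∷_; _++_; length; tabulate)
open import Data.List.Relation.Unary.All using (All; []; _∷_)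
import Data.List.Relation.Unary.All as All
import Data.List.Relation.Unary.All.Properties as All
import Data.List.Properties as List
open import Data.Product using (_×_; _,_; ∃; ∃₂)
open import Data.Sum using (_⊎_; inj₁; inj₂)
open import Data.Empty using (⊥-elim)
open import Function using (_∘_; case_of_)
open import Relation.Nullary using (does; yes; no)
open import Relation.Nullary.Decidable using (dec-true; dec-false; _×-dec_; ¬?; decidable-stable)
open import Relation.Binary.PropositionalEquality
  using (_≡_; _≢_; refl; sym; trans; cong; cong₂; subst; subst₂; module ≡-Reasoning)

open +-*-Solver using (solve; con; _:+_; _:-_; _:*_; _:=_)
open ≡-Reasoning

sumℚ-cong : ∀ {p} {f g : Fin p → ℚ} → (∀ i → f i ≡ g i) → sumℚ f ≡ sumℚ g
sumℚ-cong {zero}  f≗g = refl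
sumℚ-cong {suc p} f≗g = cong₂ _+_ (f≗g zero) (sumℚ-cong (f≗g ∘ suc))

sumℚ-zero : ∀ {p} {f : Fin p → ℚ} → (∀ i → f i ≡ 0ℚ) → sumℚ f ≡ 0ℚ
sumℚ-zero {zero}  f≗0 = refl
sumℚ-zero {suc p} f≗0 = cong₂ _+_ (f≗0 zero) (sumℚ-zero (f≗0 ∘ suc))

sumℚ-single : ∀ {p} {f : Fin p → ℚ} (i : Fin p) → (∀ j → j ≢ i → f j ≡ 0ℚ) → sumℚ f ≡ f i
sumℚ-single {suc p} {f} zero    rest = begin
  f zero + sumℚ (f ∘ suc)  ≡⟨ cong (f zero +_) (sumℚ-zero (λ j → rest (suc j) λ ())) ⟩
  f zero + 0ℚ              ≡⟨ ℚ.+-identityʳ (f zero) ⟩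
  f zero                   ∎
sumℚ-single {suc p} {f} (suc i) rest = begin
  f zero + sumℚ (f ∘ suc)  ≡⟨ cong₂ _+_ (rest zero λ ()) (sumℚ-single i rest′) ⟩
  0ℚ + f (suc i)           ≡⟨ ℚ.+-identityˡ (f (suc i)) ⟩
  f (suc i)                ∎
  where
  rest′ : ∀ j → j ≢ i → f (suc j) ≡ 0ℚ
  rest′ j j≢i = rest (suc j) (j≢i ∘ Fin.suc-injective)

sumℚ-+ : ∀ {p} (f g : Fin p → ℚ) → sumℚ (λ i → f i + g i) ≡ sumℚ f + sumℚ g
sumℚ-+ {zero}  f g = refl
sumℚ-+ {suc p} f g = trans (cong (f zero + g zero +_) (sumℚ-+ (f ∘ suc) (g ∘ suc)))
  (solve 4 (λ a b c d → (a :+ b) :+ (c :+ d) := (a :+ c) :+ (b :+ d)) refl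
     (f zero) (g zero) (sumℚ (f ∘ suc)) (sumℚ (g ∘ suc)))

sumℚ-sub : ∀ {p} (f g : Fin p → ℚ) → sumℚ (λ i → f i - g i) ≡ sumℚ f - sumℚ g
sumℚ-sub {zero}  f g = refl
sumℚ-sub {suc p} f g = trans (cong (f zero - g zero +_) (sumℚ-sub (f ∘ suc) (g ∘ suc)))
  (solve 4 (λ a b c d → (a :- b) :+ (c :- d) := (a :+ c) :- (b :+ d)) refl
     (f zero) (g zero) (sumℚ (f ∘ suc)) (sumℚ (g ∘ suc)))

sumℚ-scale : ∀ {p} (t : ℚ) (f : Fin p → ℚ) → sumℚ (λ i → t * f i) ≡ t * sumℚ f
sumℚ-scale {zero}  t f = sym (ℚ.*-zeroʳ t)
sumℚ-scale {suc p} t f = trans (cong (t * f zero +_) (sumℚ-scale t (f ∘ suc)))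
  (sym (ℚ.*-distribˡ-+ t (f zero) (sumℚ (f ∘ suc))))

sumℚ-comm : ∀ {p q} (f : Fin p → Fin q → ℚ) →
  sumℚ (λ i → sumℚ (f i)) ≡ sumℚ (λ j → sumℚ (λ i → f i j))
sumℚ-comm {zero}  {q} f = sym (sumℚ-zero {q} (λ _ → refl))
sumℚ-comm {suc p}     f = trans (cong (sumℚ (f zero) +_) (sumℚ-comm (f ∘ suc)))
  (sym (sumℚ-+ (f zero) (λ j → sumℚ (λ i → f (suc i) j))))

Matrix : ℕ → ℕ → Set
Matrix m n = Fin m → Fin n → ℚ

infix 7 _·_

_·_ : ∀ {p} → Vector ℚ p → Vector ℚ p → ℚ
x · u = sumℚ (λ a → x a * u a)

⟨_,_⟩ : ∀ {m n} → Matrix m n → Matrix m n → ℚ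
⟨ c , φ ⟩ = sumℚ (λ a → c a · φ a)

·-congʳ : ∀ {p} (x : Vector ℚ p) {u v : Vector ℚ p} → (∀ a → u a ≡ v a) → x · u ≡ x · v
·-congʳ x u≗v = sumℚ-cong (λ a → cong (x a *_) (u≗v a))

·-scaleʳ : ∀ {p} (x : Vector ℚ p) (t : ℚ) (u : Vector ℚ p) → x · (λ a → t * u a) ≡ t * (x · u)
·-scaleʳ x t u = trans
  (sumℚ-cong (λ a → solve 3 (λ x t u → x :* (t :* u) := t :* (x :* u)) refl (x a) t (u a)))
  (sumℚ-scale t (λ a → x a * u a))

·-subʳ : ∀ {p} (x u v : Vector ℚ p) → x · (λ a → u a - v a) ≡ x · u - x · v
·-subʳ x u v = trans
  (sumℚ-cong (λ a → solve 3 (λ x u v → x :* (u :- v) := x :* u :- x :* v) refl (x a) (u a) (v a)))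
  (sumℚ-sub (λ a → x a * u a) (λ a → x a * v a))

·-sumʳ : ∀ {p q} (x : Vector ℚ p) (v : Fin q → Vector ℚ p) →
  x · (λ a → sumℚ (λ j → v j a)) ≡ sumℚ (λ j → x · v j)
·-sumʳ x v = trans (sumℚ-cong (λ a → sym (sumℚ-scale (x a) (λ j → v j a))))
                   (sumℚ-comm (λ a j → x a * v j a))

·-sub-scaledˡ : ∀ {p} (u v : Vector ℚ p) (t : ℚ) (x : Vector ℚ p) →
  (λ a → u a - t * v a) · x ≡ u · x - t * (v · x)
·-sub-scaledˡ u v t x = begin
  sumℚ (λ a → (u a - t * v a) * x a)        ≡⟨ sumℚ-cong (λ a → distribute (u a) (v a) (x a)) ⟩
  sumℚ (λ a → u a * x a - t * (v a * x a))  ≡⟨ sumℚ-sub (λ a → u a * x a) (λ a → t * (v a * x a)) ⟩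
  u · x - sumℚ (λ a → t * (v a * x a))      ≡⟨ cong (u · x -_) (sumℚ-scale t (λ a → v a * x a)) ⟩
  u · x - t * (v · x)                       ∎
  where
  distribute : ∀ u v x → (u - t * v) * x ≡ u * x - t * (v * x)
  distribute = solve 4 (λ t u v x → (u :- t :* v) :* x := u :* x :- t :* (v :* x)) refl t

⟨⟩-sub-scaledˡ : ∀ {m n} (c d : Matrix m n) (t : ℚ) (φ : Matrix m n) →
  ⟨ (λ a b → c a b - t * d a b) , φ ⟩ ≡ ⟨ c , φ ⟩ - t * ⟨ d , φ ⟩
⟨⟩-sub-scaledˡ c d t φ = begin
  sumℚ (λ a → (λ b → c a b - t * d a b) · φ a)  ≡⟨ sumℚ-cong (λ a → ·-sub-scaledˡ (c a) (d a) t (φ a)) ⟩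
  sumℚ (λ a → c a · φ a - t * (d a · φ a))      ≡⟨ sumℚ-sub (λ a → c a · φ a) (λ a → t * (d a · φ a)) ⟩
  ⟨ c , φ ⟩ - sumℚ (λ a → t * (d a · φ a))      ≡⟨ cong (⟨ c , φ ⟩ -_) (sumℚ-scale t (λ a → d a · φ a)) ⟩
  ⟨ c , φ ⟩ - t * ⟨ d , φ ⟩                     ∎

transpose-· : ∀ {m n} (c : Matrix m n) (u : Vector ℚ m) (v : Vector ℚ n) →
  (λ a → c a · v) · u ≡ (λ b → (λ a → c a b) · u) · v
transpose-· c u v = begin
  sumℚ (λ a → sumℚ (λ b → c a b * v b) * u a)
    ≡⟨ sumℚ-cong (λ a → trans (ℚ.*-comm _ (u a)) (sym (sumℚ-scale (u a) (λ b → c a b * v b)))) ⟩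
  sumℚ (λ a → sumℚ (λ b → u a * (c a b * v b)))
    ≡⟨ sumℚ-comm (λ a b → u a * (c a b * v b)) ⟩
  sumℚ (λ b → sumℚ (λ a → u a * (c a b * v b)))
    ≡⟨ sumℚ-cong (λ b → sumℚ-cong (λ a → rearrange (u a) (c a b) (v b))) ⟩
  sumℚ (λ b → sumℚ (λ a → v b * (c a b * u a)))
    ≡⟨ sumℚ-cong (λ b → trans (sumℚ-scale (v b) (λ a → c a b * u a)) (ℚ.*-comm (v b) _)) ⟩
  sumℚ (λ b → sumℚ (λ a → c a b * u a) * v b)
    ∎
  where
  rearrange : ∀ u c v → u * (c * v) ≡ v * (c * u)
  rearrange = solve 3 (λ u c v → u :* (c :* v) := v :* (c :* u)) refl

sumℕ-cong : ∀ {p} {f g : Fin p → ℕ} → (∀ i → f i ≡ g i) → sumℕ f ≡ sumℕ g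
sumℕ-cong {zero}  f≗g = refl
sumℕ-cong {suc p} f≗g = cong₂ ℕ._+_ (f≗g zero) (sumℕ-cong (f≗g ∘ suc))

sumℕ-suc : ∀ {p} {f g : Fin p → ℕ} (i : Fin p) → (∀ j → j ≢ i → f j ≡ g j) →
  f i ≡ suc (g i) → sumℕ f ≡ suc (sumℕ g)
sumℕ-suc {suc p}         zero    rest fi≡ = cong₂ ℕ._+_ fi≡ (sumℕ-cong (λ j → rest (suc j) λ ()))
sumℕ-suc {suc p} {g = g} (suc i) rest fi≡ =
  trans (cong₂ ℕ._+_ (rest zero λ ()) (sumℕ-suc i (λ j j≢i → rest (suc j) (j≢i ∘ Fin.suc-injective)) fi≡))
        (ℕ.+-suc (g zero) (sumℕ (g ∘ suc)))

sumℕ-pos : ∀ {p} (f : Fin p → ℕ) → 0 < sumℕ f → ∃ λ i → 0 < f i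
sumℕ-pos {suc p} f pos with f zero in f₀≡
... | zero  = case sumℕ-pos (f ∘ suc) pos of λ { (i , fi>0) → suc i , fi>0 }
... | suc _ = zero , subst (0 <_) (sym f₀≡) (s≤s z≤n)

count : ∀ {p} → (Fin p → Bool) → ℕ
count U = sumℕ (λ a → bit (U a))

card≡count : ∀ {p} (A′ : Subset p) → card A′ ≡ count (lookup A′)
card≡count []           = refl
card≡count (true  ∷ A′) = cong suc (card≡count A′)
card≡count (false ∷ A′) = card≡count A′

count-pos : ∀ {p} (U : Fin p → Bool) → 0 < count U → ∃ λ a → U a ≡ true
count-pos U pos with sumℕ-pos (λ a → bit (U a)) pos
... | a , bit>0 with U a in Ua
...   | true  = a , Ua
...   | false = case bit>0 of λ ()

remove : ∀ {p} → Fin p → (Fin p → Bool) → Fin p → Bool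
remove a U a′ = if does (a ≟ a′) then false else U a′

remove-same : ∀ {p} (U : Fin p → Bool) (a : Fin p) → remove a U a ≡ false
remove-same U a rewrite dec-true (a ≟ a) refl = refl

remove-≢ : ∀ {p} {a a′ : Fin p} (U : Fin p → Bool) → a ≢ a′ → remove a U a′ ≡ U a′
remove-≢ {a = a} {a′} U a≢a′ rewrite dec-false (a ≟ a′) a≢a′ = refl

count-remove : ∀ {p} (U : Fin p → Bool) {a : Fin p} → U a ≡ true → count U ≡ suc (count (remove a U))
count-remove U {a} Ua = sumℕ-suc a (λ a′ a′≢a → cong bit (sym (remove-≢ U (a′≢a ∘ sym))))
  (trans (cong bit Ua) (cong (suc ∘ bit) (sym (remove-same U a))))

deleteEdge-same-row : ∀ {m n} (T : EdgeSet m n) a b b′ → deleteEdge T a b a b′ ≡ remove b (T a) b′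
deleteEdge-same-row T a b b′ rewrite dec-true (a ≟ a) refl = refl

deleteEdge-other-row : ∀ {m n} (T : EdgeSet m n) {a a′} b b′ → a ≢ a′ → deleteEdge T a b a′ b′ ≡ T a′ b′
deleteEdge-other-row T {a} {a′} b b′ a≢a′ rewrite dec-false (a ≟ a′) a≢a′ = refl

deleteEdge-⊆ : ∀ {m n} (T : EdgeSet m n) a b → SubEdges (deleteEdge T a b) T
deleteEdge-⊆ T a b a′ b′ with does (a ≟ a′) ∧ does (b ≟ b′)
... | true  = λ ()
... | false = λ Ta′b′ → Ta′b′

⊆-deleteEdge : ∀ {m n} {S T : EdgeSet m n} {a b} → SubEdges S T → S a b ≡ false →
  SubEdges S (deleteEdge T a b)
⊆-deleteEdge {a = a} {b} S⊆T Sab a′ b′ Sa′b′ with a ≟ a′ | b ≟ b′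
... | yes refl | yes refl = case trans (sym Sa′b′) Sab of λ ()
... | yes _    | no _     = S⊆T a′ b′ Sa′b′
... | no _     | _        = S⊆T a′ b′ Sa′b′

numEdges-deleteEdge : ∀ {m n} (T : EdgeSet m n) {a b} → T a b ≡ true →
  numEdges T ≡ suc (numEdges (deleteEdge T a b))
numEdges-deleteEdge T {a} {b} Tab = sumℕ-suc a
  (λ a′ a′≢a → sumℕ-cong (λ b′ → cong bit (sym (deleteEdge-other-row T b b′ (a′≢a ∘ sym)))))
  (trans (count-remove (T a) Tab) (cong suc (sumℕ-cong (λ b′ → cong bit (sym (deleteEdge-same-row T a b b′))))))

numEdges-⊆-antisym : ∀ {m n} {S T : EdgeSet m n} → SubEdges S T → SubEdges T S → numEdges S ≡ numEdges T
numEdges-⊆-antisym {S = S} {T} S⊆T T⊆S = sumℕ-cong λ a → sumℕ-cong λ b → cong bit (pointwise a b)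
  where
  pointwise : ∀ a b → S a b ≡ T a b
  pointwise a b with S a b in Sab
  ... | true  = sym (S⊆T a b Sab)
  ... | false = sym (¬-not λ Tab → case trans (sym (T⊆S a b Tab)) Sab of λ ())

edge-of-nonempty : ∀ {m n} (T : EdgeSet m n) → 0 < numEdges T → ∃₂ λ a b → T a b ≡ true
edge-of-nonempty T pos with sumℕ-pos (λ a → count (T a)) pos
... | a , pos-a = a , count-pos (T a) pos-a

-- More unknowns than equations

SupportedIn : ∀ {p} → (Fin p → Bool) → Vector ℚ p → Set
SupportedIn U x = ∀ a → U a ≡ false → x a ≡ 0ℚ

Supported : ∀ {m n} → EdgeSet m n → Matrix m n → Set
Supported T c = ∀ a → SupportedIn (T a) (c a)

Supported-mono : ∀ {m n} {S T : EdgeSet m n} {c} → SubEdges S T → Supported S c → Supported T c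
Supported-mono S⊆T c-supp a b Tab = c-supp a b (¬-not λ Sab → case trans (sym (S⊆T a b Sab)) Tab of λ ())

Supported-nonzero⇒edge : ∀ {m n} {T : EdgeSet m n} {c a b} → Supported T c → c a b ≢ 0ℚ → T a b ≡ true
Supported-nonzero⇒edge c-supp cab≢0 = ¬-not (cab≢0 ∘ c-supp _ _)

Nontrivial : ∀ {m n} → Matrix m n → Set
Nontrivial c = ∃₂ λ a b → c a b ≢ 0ℚ

Orthogonal : ∀ {m n} → Matrix m n → List (Matrix m n) → Set
Orthogonal c = All (λ φ → ⟨ c , φ ⟩ ≡ 0ℚ)

-- y′ vanishes at an edge where y does not, so y − t y′ stays nonzero there for every t;
-- t is chosen to make it orthogonal to φ.
eliminate : ∀ {m n} {T : EdgeSet m n} {L} (φ : Matrix m n) {y y′ : Matrix m n} {a b} →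
  Supported T y → Supported T y′ → Orthogonal y L → Orthogonal y′ L →
  y a b ≢ 0ℚ → y′ a b ≡ 0ℚ → ⟨ y′ , φ ⟩ ≢ 0ℚ →
  ∃ λ z → Supported T z × Nontrivial z × Orthogonal z (φ ∷ L)
eliminate {T = T} φ {y} {y′} {a} {b} y-supp y′-supp y⊥L y′⊥L yab≢0 y′ab≡0 y′φ≢0 =
  z , z-supp , (a , b , zab≢0) , z⊥φ ∷ All.zipWith (λ (y⊥ψ , y′⊥ψ) → z⊥ y⊥ψ y′⊥ψ) (y⊥L , y′⊥L)
  where
  instance _ = ≢-nonZero y′φ≢0
  t : ℚ
  t = ⟨ y , φ ⟩ * 1/ ⟨ y′ , φ ⟩
  z : Matrix _ _
  z a′ b′ = y a′ b′ - t * y′ a′ b′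
  combine-zeros : ∀ {p q} → p ≡ 0ℚ → q ≡ 0ℚ → p - t * q ≡ 0ℚ
  combine-zeros refl refl = solve 1 (λ t → con 0ℚ :- t :* con 0ℚ := con 0ℚ) refl t
  z-supp : Supported T z
  z-supp a′ b′ Ta′b′ = combine-zeros (y-supp a′ b′ Ta′b′) (y′-supp a′ b′ Ta′b′)
  zab≢0 : z a b ≢ 0ℚ
  zab≢0 zab≡0 = yab≢0 (begin
    y a b                ≡⟨ solve 2 (λ u t → u := u :- t :* con 0ℚ) refl (y a b) t ⟩
    y a b - t * 0ℚ       ≡⟨ cong (λ u → y a b - t * u) (sym y′ab≡0) ⟩
    z a b                ≡⟨ zab≡0 ⟩
    0ℚ                   ∎)
  z⊥ : ∀ {ψ} → ⟨ y , ψ ⟩ ≡ 0ℚ → ⟨ y′ , ψ ⟩ ≡ 0ℚ → ⟨ z , ψ ⟩ ≡ 0ℚ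
  z⊥ {ψ} y⊥ψ y′⊥ψ = trans (⟨⟩-sub-scaledˡ y y′ t ψ) (combine-zeros y⊥ψ y′⊥ψ)
  z⊥φ : ⟨ z , φ ⟩ ≡ 0ℚ
  z⊥φ = begin
    ⟨ z , φ ⟩                                    ≡⟨ ⟨⟩-sub-scaledˡ y y′ t φ ⟩
    ⟨ y , φ ⟩ - t * ⟨ y′ , φ ⟩                   ≡⟨ cong (⟨ y , φ ⟩ -_) (ℚ.*-assoc ⟨ y , φ ⟩ _ _) ⟩
    ⟨ y , φ ⟩ - ⟨ y , φ ⟩ * (1/ ⟨ y′ , φ ⟩ * ⟨ y′ , φ ⟩)
      ≡⟨ cong (λ u → ⟨ y , φ ⟩ - ⟨ y , φ ⟩ * u) (ℚ.*-inverseˡ ⟨ y′ , φ ⟩) ⟩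
    ⟨ y , φ ⟩ - ⟨ y , φ ⟩ * 1ℚ                   ≡⟨ solve 1 (λ p → p :- p :* con 1ℚ := con 0ℚ) refl ⟨ y , φ ⟩ ⟩
    0ℚ                                           ∎

nontrivial-solution : ∀ {m n} (L : List (Matrix m n)) (T : EdgeSet m n) → length L < numEdges T →
  ∃ λ c → Supported T c × Nontrivial c × Orthogonal c L
nontrivial-solution [] T pos with edge-of-nonempty T pos
... | a , b , Tab = indicator , indicator-supp , (a , b , indicator-edge) , []
  where
  indicator : Matrix _ _
  indicator a′ b′ = if T a′ b′ then 1ℚ else 0ℚ
  indicator-supp : Supported T indicator
  indicator-supp a′ b′ Ta′b′ rewrite Ta′b′ = refl
  indicator-edge : indicator a b ≢ 0ℚ
  indicator-edge rewrite Tab = λ ()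
nontrivial-solution (φ ∷ L) T |φ∷L|<|T|
  with nontrivial-solution L T (ℕ.<-trans (ℕ.n<1+n _) |φ∷L|<|T|)
... | y , y-supp , (a , b , yab≢0) , y⊥L
  with nontrivial-solution L (deleteEdge T a b) (ℕ.s≤s⁻¹ (subst (suc (length L) <_)
         (numEdges-deleteEdge T (Supported-nonzero⇒edge y-supp yab≢0)) |φ∷L|<|T|))
... | y′ , y′-supp , y′-nontrivial , y′⊥L with ⟨ y′ , φ ⟩ ℚ.≟ 0ℚ
...   | yes y′⊥φ = y′ , Supported-mono (deleteEdge-⊆ T a b) y′-supp , y′-nontrivial , y′⊥φ ∷ y′⊥L
...   | no  y′φ≢0 = eliminate φ y-supp (Supported-mono (deleteEdge-⊆ T a b) y′-supp) y⊥L y′⊥L yab≢0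
                      (y′-supp a b (trans (deleteEdge-same-row T a b b) (remove-same (T a) b))) y′φ≢0

-- Reduced echelon form

-- The rows span those of Θ restricted to the columns U; `annihilates` states this dually.
record ReducedEchelon {k m} (Θ : Fin k → Vector ℚ m) (U : Fin m → Bool) : Set where
  field
    rank        : ℕ
    rank≤k      : rank ≤ k
    row         : Fin rank → Vector ℚ m
    pivot       : Fin rank → Fin m
    free        : Fin m → Bool
    count-free  : count free ℕ.+ rank ≡ count U
    row-pivot   : ∀ j → row j (pivot j) ≡ 1ℚ
    row-pivot-≢ : ∀ i j → i ≢ j → row i (pivot j) ≡ 0ℚ
    classify    : ∀ a → U a ≡ false ⊎ free a ≡ true ⊎ ∃ λ j → pivot j ≡ a
    annihilates : ∀ x → SupportedIn U x → (∀ j → x · row j ≡ 0ℚ) → ∀ i → x · Θ i ≡ 0ℚ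

  zero-on-free⇒zero : ∀ w → SupportedIn U w → (∀ a → free a ≡ true → w a ≡ 0ℚ) →
    (∀ j → w · row j ≡ 0ℚ) → ∀ a → w a ≡ 0ℚ
  zero-on-free⇒zero w w-supp w-free w⊥ a with classify a
  ... | inj₁ Ua≡false          = w-supp a Ua≡false
  ... | inj₂ (inj₁ free-a)     = w-free a free-a
  ... | inj₂ (inj₂ (j , refl)) = begin
    w (pivot j)                    ≡⟨ sym (ℚ.*-identityʳ (w (pivot j))) ⟩
    w (pivot j) * 1ℚ               ≡⟨ cong (w (pivot j) *_) (sym (row-pivot j)) ⟩
    w (pivot j) * row j (pivot j)  ≡⟨ sym (sumℚ-single (pivot j) off-pivot) ⟩
    w · row j                      ≡⟨ w⊥ j ⟩
    0ℚ                             ∎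
    where
    off-pivot : ∀ a → a ≢ pivot j → w a * row j a ≡ 0ℚ
    off-pivot a a≢pj with classify a
    ... | inj₁ Ua≡false          = trans (cong (_* row j a) (w-supp a Ua≡false)) (ℚ.*-zeroˡ (row j a))
    ... | inj₂ (inj₁ free-a)     = trans (cong (_* row j a) (w-free a free-a)) (ℚ.*-zeroˡ (row j a))
    ... | inj₂ (inj₂ (i , refl)) = trans (cong (w (pivot i) *_) (row-pivot-≢ j i (a≢pj ∘ cong pivot ∘ sym)))
                                         (ℚ.*-zeroʳ (w (pivot i)))

module _ {k m} {Θ : Fin (suc k) → Vector ℚ m} {U : Fin m → Bool} (e : ReducedEchelon (Θ ∘ suc) U) where
  open ReducedEchelon e

  residual : Vector ℚ m
  residual a = Θ zero a - sumℚ (λ j → Θ zero (pivot j) * row j a)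

  residual-pivot : ∀ j → residual (pivot j) ≡ 0ℚ
  residual-pivot j = begin
    θ₀ (pivot j) - sumℚ (λ i → θ₀ (pivot i) * row i (pivot j))
      ≡⟨ cong (θ₀ (pivot j) -_) (sumℚ-single j off-diagonal) ⟩
    θ₀ (pivot j) - θ₀ (pivot j) * row j (pivot j)
      ≡⟨ cong (λ u → θ₀ (pivot j) - θ₀ (pivot j) * u) (row-pivot j) ⟩
    θ₀ (pivot j) - θ₀ (pivot j) * 1ℚ
      ≡⟨ solve 1 (λ t → t :- t :* con 1ℚ := con 0ℚ) refl (θ₀ (pivot j)) ⟩
    0ℚ
      ∎
    where
    θ₀ = Θ zero
    off-diagonal : ∀ i → i ≢ j → θ₀ (pivot i) * row i (pivot j) ≡ 0ℚ
    off-diagonal i i≢j = trans (cong (θ₀ (pivot i) *_) (row-pivot-≢ i j i≢j)) (ℚ.*-zeroʳ (θ₀ (pivot i)))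

  ·-residual : ∀ x → (∀ j → x · row j ≡ 0ℚ) → x · residual ≡ x · Θ zero
  ·-residual x x⊥ = begin
    x · residual                         ≡⟨ ·-subʳ x (Θ zero) _ ⟩
    x · Θ zero - x · combination         ≡⟨ cong (x · Θ zero -_) ⊥combination ⟩
    x · Θ zero - 0ℚ                      ≡⟨ solve 1 (λ u → u :- con 0ℚ := u) refl (x · Θ zero) ⟩
    x · Θ zero                           ∎
    where
    combination : Vector ℚ m
    combination a = sumℚ (λ j → Θ zero (pivot j) * row j a)
    ⊥combination : x · combination ≡ 0ℚ
    ⊥combination = trans (·-sumʳ x (λ j a → Θ zero (pivot j) * row j a)) (sumℚ-zero λ j →
      trans (·-scaleʳ x (Θ zero (pivot j)) (row j))
            (trans (cong (Θ zero (pivot j) *_) (x⊥ j)) (ℚ.*-zeroʳ (Θ zero (pivot j)))))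

  extend-dependent : (∀ a → free a ≡ true → residual a ≡ 0ℚ) → ReducedEchelon Θ U
  extend-dependent residual-free = record
    { rank = rank ; rank≤k = ℕ.m≤n⇒m≤1+n rank≤k ; row = row ; pivot = pivot ; free = free
    ; count-free = count-free ; row-pivot = row-pivot ; row-pivot-≢ = row-pivot-≢ ; classify = classify
    ; annihilates = annihilates′ }
    where
    annihilates′ : ∀ x → SupportedIn U x → (∀ j → x · row j ≡ 0ℚ) → ∀ i → x · Θ i ≡ 0ℚ
    annihilates′ x x-supp x⊥ (suc i) = annihilates x x-supp x⊥ i
    annihilates′ x x-supp x⊥ zero    = trans (sym (·-residual x x⊥)) (sumℚ-zero term-zero)
      where
      term-zero : ∀ a → x a * residual a ≡ 0ℚ
      term-zero a with classify a
      ... | inj₁ Ua≡false          = trans (cong (_* residual a) (x-supp a Ua≡false)) (ℚ.*-zeroˡ (residual a))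
      ... | inj₂ (inj₁ free-a)     = trans (cong (x a *_) (residual-free a free-a)) (ℚ.*-zeroʳ (x a))
      ... | inj₂ (inj₂ (j , refl)) = trans (cong (x a *_) (residual-pivot j)) (ℚ.*-zeroʳ (x a))

  module _ {a₀ : Fin m} (free-a₀ : free a₀ ≡ true) (residual-a₀≢0 : residual a₀ ≢ 0ℚ) where
    private
      r₀ : ℚ
      r₀ = residual a₀
      instance _ = ≢-nonZero residual-a₀≢0

    pivotRow : Vector ℚ m
    pivotRow a = 1/ r₀ * residual a

    pivotRow-pivot : ∀ j → pivotRow (pivot j) ≡ 0ℚ
    pivotRow-pivot j = trans (cong (1/ r₀ *_) (residual-pivot j)) (ℚ.*-zeroʳ (1/ r₀))

    residual≡ : ∀ a → residual a ≡ r₀ * pivotRow a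
    residual≡ a = begin
      residual a               ≡⟨ sym (ℚ.*-identityˡ (residual a)) ⟩
      1ℚ * residual a          ≡⟨ cong (_* residual a) (sym (ℚ.*-inverseʳ r₀)) ⟩
      r₀ * 1/ r₀ * residual a  ≡⟨ ℚ.*-assoc r₀ (1/ r₀) (residual a) ⟩
      r₀ * pivotRow a          ∎

    row′ : Fin (suc rank) → Vector ℚ m
    row′ = pivotRow ◂ λ j a → row j a - row j a₀ * pivotRow a

    pivot′ : Fin (suc rank) → Fin m
    pivot′ = a₀ ◂ pivot

    row′-pivot : ∀ j → row′ j (pivot′ j) ≡ 1ℚ
    row′-pivot zero    = ℚ.*-inverseˡ r₀
    row′-pivot (suc j) = trans (cong₂ (λ u v → u - row j a₀ * v) (row-pivot j) (pivotRow-pivot j))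
                               (solve 1 (λ t → con 1ℚ :- t :* con 0ℚ := con 1ℚ) refl (row j a₀))

    row′-pivot-≢ : ∀ i j → i ≢ j → row′ i (pivot′ j) ≡ 0ℚ
    row′-pivot-≢ zero    zero    i≢j = ⊥-elim (i≢j refl)
    row′-pivot-≢ zero    (suc j) _   = pivotRow-pivot j
    row′-pivot-≢ (suc i) zero    _   = trans (cong (λ v → row i a₀ - row i a₀ * v) (ℚ.*-inverseˡ r₀))
                                             (solve 1 (λ t → t :- t :* con 1ℚ := con 0ℚ) refl (row i a₀))
    row′-pivot-≢ (suc i) (suc j) i≢j =
      trans (cong₂ (λ u v → u - row i a₀ * v) (row-pivot-≢ i j (i≢j ∘ cong suc)) (pivotRow-pivot j))
            (solve 1 (λ t → con 0ℚ :- t :* con 0ℚ := con 0ℚ) refl (row i a₀))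

    classify′ : ∀ a → U a ≡ false ⊎ remove a₀ free a ≡ true ⊎ ∃ λ j → pivot′ j ≡ a
    classify′ a with classify a
    ... | inj₁ Ua≡false          = inj₁ Ua≡false
    ... | inj₂ (inj₂ (j , pj≡a)) = inj₂ (inj₂ (suc j , pj≡a))
    ... | inj₂ (inj₁ free-a) with a₀ ≟ a
    ...   | yes a₀≡a = inj₂ (inj₂ (zero , a₀≡a))
    ...   | no  _    = inj₂ (inj₁ free-a)

    ⊥row′⇒⊥row : ∀ x → (∀ j → x · row′ j ≡ 0ℚ) → ∀ j → x · row j ≡ 0ℚ
    ⊥row′⇒⊥row x x⊥ j = begin
      x · row j                                       ≡⟨ solve 2 (λ u t → u := u :- t :* con 0ℚ) refl _ (row j a₀) ⟩
      x · row j - row j a₀ * 0ℚ                       ≡⟨ cong (λ v → x · row j - row j a₀ * v) (sym (x⊥ zero)) ⟩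
      x · row j - row j a₀ * (x · pivotRow)           ≡⟨ cong (x · row j -_) (sym (·-scaleʳ x (row j a₀) pivotRow)) ⟩
      x · row j - x · (λ a → row j a₀ * pivotRow a)  ≡⟨ sym (·-subʳ x (row j) _) ⟩
      x · row′ (suc j)                                ≡⟨ x⊥ (suc j) ⟩
      0ℚ                                              ∎

    annihilates′ : ∀ x → SupportedIn U x → (∀ j → x · row′ j ≡ 0ℚ) → ∀ i → x · Θ i ≡ 0ℚ
    annihilates′ x x-supp x⊥ (suc i) = annihilates x x-supp (⊥row′⇒⊥row x x⊥) i
    annihilates′ x x-supp x⊥ zero    = begin
      x · Θ zero                   ≡⟨ sym (·-residual x (⊥row′⇒⊥row x x⊥)) ⟩
      x · residual                 ≡⟨ ·-congʳ x residual≡ ⟩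
      x · (λ a → r₀ * pivotRow a)  ≡⟨ ·-scaleʳ x r₀ pivotRow ⟩
      r₀ * (x · pivotRow)          ≡⟨ cong (r₀ *_) (x⊥ zero) ⟩
      r₀ * 0ℚ                      ≡⟨ ℚ.*-zeroʳ r₀ ⟩
      0ℚ                           ∎

    extend-pivot : ReducedEchelon Θ U
    extend-pivot = record
      { rank = suc rank ; rank≤k = s≤s rank≤k ; row = row′ ; pivot = pivot′ ; free = remove a₀ free
      ; count-free = trans (ℕ.+-suc _ rank) (trans (cong (ℕ._+ rank) (sym (count-remove free free-a₀)))
                                                  count-free)
      ; row-pivot = row′-pivot ; row-pivot-≢ = row′-pivot-≢ ; classify = classify′
      ; annihilates = annihilates′ }

  extend : ReducedEchelon Θ U
  extend with any? (λ a → (free a ≟ᵇ true) ×-dec ¬? (residual a ℚ.≟ 0ℚ))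
  ... | yes (a₀ , free-a₀ , residual-a₀≢0) = extend-pivot free-a₀ residual-a₀≢0
  ... | no  no-new-pivot = extend-dependent λ a free-a →
          decidable-stable (residual a ℚ.≟ 0ℚ) (λ residual-a≢0 → no-new-pivot (a , free-a , residual-a≢0))

reducedEchelon : ∀ {k m} (Θ : Fin k → Vector ℚ m) (U : Fin m → Bool) → ReducedEchelon Θ U
reducedEchelon {zero}  Θ U = record
  { rank = 0 ; rank≤k = z≤n ; row = λ () ; pivot = no-pivot ; free = U ; count-free = ℕ.+-identityʳ (count U)
  ; row-pivot = λ () ; row-pivot-≢ = λ () ; classify = classify ; annihilates = λ _ _ _ () }
  where
  no-pivot : Fin 0 → Fin _
  no-pivot ()
  classify : ∀ a → U a ≡ false ⊎ U a ≡ true ⊎ ∃ λ j → no-pivot j ≡ a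
  classify a with U a
  ... | false = inj₁ refl
  ... | true  = inj₂ (inj₁ refl)
reducedEchelon {suc k} Θ U = extend (reducedEchelon (Θ ∘ suc) U)

-- Stresses of induced subgraphs

column : ∀ {k l m n} → Params k l m n → Col k l m n → Matrix m n
column θ col a b = rigEntry θ a b col

Stress : ∀ {k l m n} → Params k l m n → Matrix m n → Set
Stress θ c = ∀ col → ⟨ c , column θ col ⟩ ≡ 0ℚ

module _ {k l m n} (θA : Fin k → Vector ℚ m) (θB : Fin l → Vector ℚ n) (c : Matrix m n) where

  ⟨⟩-columnᴬ : ∀ a i → ⟨ c , column (θA , θB) (inj₁ (a , i)) ⟩ ≡ c a · θB i
  ⟨⟩-columnᴬ a i = trans (sumℚ-single a other-row) (·-congʳ (c a) own-row)
    where
    other-row : ∀ a′ → a′ ≢ a → c a′ · column (θA , θB) (inj₁ (a , i)) a′ ≡ 0ℚ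
    other-row a′ a′≢a rewrite dec-false (a′ ≟ a) a′≢a = sumℚ-zero λ b → ℚ.*-zeroʳ (c a′ b)
    own-row : ∀ b → column (θA , θB) (inj₁ (a , i)) a b ≡ θB i b
    own-row b rewrite dec-true (a ≟ a) refl = refl

  ⟨⟩-columnᴮ : ∀ b j → ⟨ c , column (θA , θB) (inj₂ (b , j)) ⟩ ≡ (λ a → c a b) · θA j
  ⟨⟩-columnᴮ b j = sumℚ-cong λ a → trans (sumℚ-single b (other-column a)) (cong (c a b *_) (own-column a))
    where
    other-column : ∀ a b′ → b′ ≢ b → c a b′ * column (θA , θB) (inj₂ (b , j)) a b′ ≡ 0ℚ
    other-column a b′ b′≢b rewrite dec-false (b′ ≟ b) b′≢b = ℚ.*-zeroʳ (c a b′)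
    own-column : ∀ a → column (θA , θB) (inj₂ (b , j)) a b ≡ θA j a
    own-column a rewrite dec-true (b ≟ b) refl = refl

induced : ∀ {m n} → EdgeSet m n → (Fin m → Bool) → (Fin n → Bool) → EdgeSet m n
induced E U V a b = E a b ∧ U a ∧ V b

induced-⊆ : ∀ {m n} (E : EdgeSet m n) U V → SubEdges (induced E U V) E
induced-⊆ E U V a b with E a b
... | true  = λ _ → refl
... | false = λ ()

induced-supportᴬ : ∀ {m n} (E : EdgeSet m n) U V {c a} → Supported (induced E U V) c →
  ∀ b → U a ≡ false → c a b ≡ 0ℚ
induced-supportᴬ E U V {a = a} c-supp b Ua =
  c-supp a b (trans (cong (λ x → E a b ∧ x ∧ V b) Ua) (∧-zeroʳ (E a b)))

induced-supportᴮ : ∀ {m n} (E : EdgeSet m n) U V {c b} → Supported (induced E U V) c →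
  ∀ a → V b ≡ false → c a b ≡ 0ℚ
induced-supportᴮ E U V {b = b} c-supp a Vb =
  c-supp a b (trans (cong (λ x → E a b ∧ U a ∧ x) Vb)
                    (trans (cong (E a b ∧_) (∧-zeroʳ (U a))) (∧-zeroʳ (E a b))))

concatWhere : ∀ {p} {A : Set} → (Fin p → Bool) → (Fin p → List A) → List A
concatWhere {zero}  U f = []
concatWhere {suc p} U f = (if U zero then f zero else []) ++ concatWhere (U ∘ suc) (f ∘ suc)

length-concatWhere : ∀ {p} {A : Set} (U : Fin p → Bool) (f : Fin p → List A) {r} →
  (∀ a → length (f a) ≡ r) → length (concatWhere U f) ≡ count U ℕ.* r
length-concatWhere {zero}  U f |f|≡r = refl
length-concatWhere {suc p} U f |f|≡r with U zero
... | true  = trans (List.length-++ (f zero))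
                    (cong₂ ℕ._+_ (|f|≡r zero) (length-concatWhere (U ∘ suc) (f ∘ suc) (|f|≡r ∘ suc)))
... | false = length-concatWhere (U ∘ suc) (f ∘ suc) (|f|≡r ∘ suc)

All-concatWhere : ∀ {p} {A : Set} {P : A → Set} (U : Fin p → Bool) (f : Fin p → List A) →
  All P (concatWhere U f) → ∀ a → U a ≡ true → All P (f a)
All-concatWhere {suc p} U f all zero Ua with U zero
All-concatWhere {suc p} U f all zero refl | true = All.++⁻ˡ (f zero) all
All-concatWhere {suc p} U f all (suc a) Ua =
  All-concatWhere (U ∘ suc) (f ∘ suc) (All.++⁻ʳ (if U zero then f zero else []) all) a Ua

-- Rearranged, this is (v − l)(k − r) ≥ 0.
echelon-bound : ∀ {r k l v} u → r ≤ k → l ≤ v →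
  v ℕ.* r ℕ.+ u ℕ.* l ≤ l ℕ.* (u ℕ.+ r) ℕ.+ k ℕ.* v ∸ k ℕ.* l
echelon-bound {r} {k} {l} {v} u r≤k l≤v with ℕ.m≤n⇒∃[o]m+o≡n r≤k | ℕ.m≤n⇒∃[o]m+o≡n l≤v
... | s , refl | t , refl = ℕ.m+n≤o⇒m≤o∸n _ (ℕ.≤-trans (ℕ.m≤m+n _ (s ℕ.* t)) (ℕ.≤-reflexive expand))
  where
  open ℕ-Solver.+-*-Solver using () renaming (solve to solveℕ; _:+_ to _⊕_; _:*_ to _⊗_; _:=_ to _⊜_)
  expand : (l ℕ.+ t) ℕ.* r ℕ.+ u ℕ.* l ℕ.+ (r ℕ.+ s) ℕ.* l ℕ.+ s ℕ.* t
         ≡ l ℕ.* (u ℕ.+ r) ℕ.+ (r ℕ.+ s) ℕ.* (l ℕ.+ t)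
  expand = solveℕ 5 (λ u r s l t → (l ⊕ t) ⊗ r ⊕ u ⊗ l ⊕ (r ⊕ s) ⊗ l ⊕ s ⊗ t
                                    ⊜ l ⊗ (u ⊕ r) ⊕ (r ⊕ s) ⊗ (l ⊕ t)) refl u r s l t

module _ {k l m n} (θA : Fin k → Vector ℚ m) (θB : Fin l → Vector ℚ n)
         (E : EdgeSet m n) (U : Fin m → Bool) (V : Fin n → Bool) where
  open ReducedEchelon (reducedEchelon θA U)

  -- The B′-columns of R(θ) reduce to those of R(row , θB), and by zero-on-free⇒zero the
  -- A′-columns at pivots follow from the others; only the remaining columns are imposed.
  constraints : List (Matrix m n)
  constraints = concatWhere V (λ b → tabulate (λ j → column (row , θB) (inj₂ (b , j))))
             ++ concatWhere free (λ a → tabulate (λ i → column (row , θB) (inj₁ (a , i))))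

  length-constraints : length constraints ≡ count V ℕ.* rank ℕ.+ count free ℕ.* l
  length-constraints = trans (List.length-++ (concatWhere V _))
    (cong₂ ℕ._+_ (length-concatWhere V _ (λ b → List.length-tabulate _))
                 (length-concatWhere free _ (λ a → List.length-tabulate _)))

  orthogonal⇒stress : ∀ c → Supported (induced E U V) c → Orthogonal c constraints → Stress (θA , θB) c
  orthogonal⇒stress c c-supp c⊥ = stress
    where
    c⊥ᴮ : ∀ b j → (λ a → c a b) · row j ≡ 0ℚ
    c⊥ᴮ b j with V b in Vb
    ... | true  = trans (sym (⟨⟩-columnᴮ row θB c b j))
                        (All.tabulate⁻ (All-concatWhere V _ (All.++⁻ˡ _ c⊥) b Vb) j)
    ... | false = sumℚ-zero λ a →
                    trans (cong (_* row j a) (induced-supportᴮ E U V c-supp a Vb)) (ℚ.*-zeroˡ (row j a))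
    stress : Stress (θA , θB) c
    stress (inj₂ (b , j)) = trans (⟨⟩-columnᴮ θA θB c b j)
      (annihilates (λ a → c a b) (λ a Ua → induced-supportᴬ E U V c-supp b Ua) (c⊥ᴮ b) j)
    stress (inj₁ (a , i)) = trans (⟨⟩-columnᴬ θA θB c a i)
      (zero-on-free⇒zero (λ a′ → c a′ · θB i) outside on-free ⊥rows a)
      where
      outside : SupportedIn U (λ a′ → c a′ · θB i)
      outside a′ Ua′ = sumℚ-zero λ b →
        trans (cong (_* θB i b) (induced-supportᴬ E U V c-supp b Ua′)) (ℚ.*-zeroˡ (θB i b))
      on-free : ∀ a′ → free a′ ≡ true → c a′ · θB i ≡ 0ℚ
      on-free a′ free-a′ = trans (sym (⟨⟩-columnᴬ row θB c a′ i))
        (All.tabulate⁻ (All-concatWhere free _ (All.++⁻ʳ (concatWhere V _) c⊥) a′ free-a′) i)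
      ⊥rows : ∀ j → (λ a′ → c a′ · θB i) · row j ≡ 0ℚ
      ⊥rows j = trans (transpose-· c (row j) (θB i))
                      (sumℚ-zero λ b → trans (cong (_* θB i b) (c⊥ᴮ b j)) (ℚ.*-zeroˡ (θB i b)))

  independent⇒sparse : RowsIndependent (θA , θB) E → l ≤ count V →
    numEdges (induced E U V) ≤ l ℕ.* count U ℕ.+ k ℕ.* count V ∸ k ℕ.* l
  independent⇒sparse independent l≤V = ℕ.≮⇒≥ λ bound<|T| →
    let c , c-supp , (a , b , cab≢0) , c⊥ =
          nontrivial-solution constraints (induced E U V) (ℕ.≤-<-trans few bound<|T|)
    in cab≢0 (independent c (Supported-mono (induced-⊆ E U V) c-supp) (orthogonal⇒stress c c-supp c⊥) a b)
    where
    few : length constraints ≤ l ℕ.* count U ℕ.+ k ℕ.* count V ∸ k ℕ.* l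
    few = subst₂ _≤_ (sym length-constraints) (cong (λ u → l ℕ.* u ℕ.+ k ℕ.* count V ∸ k ℕ.* l) count-free)
                 (echelon-bound (count free) rank≤k l≤V)

independent⇒Laman-sparse : ∀ {k l m n} {θA : Fin k → Vector ℚ m} {θB : Fin l → Vector ℚ n} {E : EdgeSet m n} →
  RowsIndependent (θA , θB) E → (A′ : Subset m) (B′ : Subset n) → l ≤ card B′ →
  inducedEdges E A′ B′ ≤ l ℕ.* card A′ ℕ.+ k ℕ.* card B′ ∸ k ℕ.* l
independent⇒Laman-sparse {θA = θA} {θB} {E} independent A′ B′ l≤B′ rewrite card≡count A′ | card≡count B′ =
  independent⇒sparse θA θB E (lookup A′) (lookup B′) independent l≤B′

GenericRankAtLeast-mono : ∀ {k l m n} {E F : EdgeSet m n} {r} → SubEdges E F →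
  GenericRankAtLeast k l E r → GenericRankAtLeast k l F r
GenericRankAtLeast-mono E⊆F (θ , S , S⊆E , |S|≡r , independent) =
  θ , S , (λ a b → E⊆F a b ∘ S⊆E a b) , |S|≡r , independent

minimal⇒independent : ∀ {k l m n} {E : EdgeSet m n} → Minimal k l E →
  ∃ λ θ → RowsIndependent θ E × numEdges E ≡ l ℕ.* m ℕ.+ k ℕ.* n ∸ k ℕ.* l
minimal⇒independent {E = E} (((θ , S , S⊆E , |S|≡N , S-independent) , ¬rank>N) , minimal) =
  θ , (λ c c-supp → S-independent c (Supported-mono E⊆S c-supp)) , trans (numEdges-⊆-antisym E⊆S S⊆E) |S|≡N
  where
  E⊆S : SubEdges E S
  E⊆S a b Eab with S a b in Sab
  ... | true  = refl
  ... | false = ⊥-elim (minimal a b Eab ((θ , S , ⊆-deleteEdge S⊆E Sab , |S|≡N , S-independent)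
                                        , ¬rank>N ∘ GenericRankAtLeast-mono (deleteEdge-⊆ E a b)))

proposition5p3 : (k l m n : ℕ) → 1 ≤ k → 1 ≤ l → k ≤ m → l ≤ n →
                 (E : EdgeSet m n) → Minimal k l E → Laman k l E
proposition5p3 k l m n _ _ _ _ E minimal with minimal⇒independent minimal
... | (θA , θB) , independent , |E|≡N =
  |E|≡N , λ A′ B′ _ l≤B′ → independent⇒Laman-sparse independent A′ B′ l≤B′
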